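{- Let $q$ be a prime power, $m>1$ an integer, and $j$ an integer with $1\le j\le m-1$ and $\gcd(j,q-1)=1$. Then the map $\lambda_j:\mathbb{F}_{q^m}\to\mathbb{F}_q$, $\alpha\mapsto\lambda_j(\alpha)$, is surjective.
   Context: $\lambda_j(x):=\sigma_j(x,x^q,\ldots,x^{q^{m-1}})=\sum_{0\le i_1<i_2<\cdots<i_j\le m-1}x^{q^{i_1}+\cdots+q^{i_j}}$, where $\sigma_j$ is the $j$-th elementary symmetric polynomial in $m$ variables. (For $\alpha\in\mathbb{F}_{q^m}$ one has $\lambda_j(\alpha)\in\mathbb{F}_q$.) -}

module Defs where

open import Level using (Level; _⊔_)
open import Algebra.Bundles using (CommutativeRing; Semiring)
open import Data.Nat using (ℕ; zero; suc; _≤_)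
open import Data.Nat.Primality using (Prime)
open import Data.Product using (Σ; ∃; _×_; _,_)
open import Data.Fin using (Fin)
open import Data.List using (List; []; _∷_; map; upTo)
open import Function.Bundles using (Inverse)
open import Relation.Nullary using (¬_)
import Relation.Binary.PropositionalEquality as ≡
import Algebra.Definitions.RawSemiring as RS

IsPrimePower : ℕ → Set
IsPrimePower q = Σ ℕ λ p → Σ ℕ λ k → Prime p × (1 ≤ k) × (q ≡.≡ Data.Nat._^_ p k)

module _ {c ℓ : Level} (R : CommutativeRing c ℓ) where
  open CommutativeRing R

  IsField : Set (c ⊔ ℓ)
  IsField = (¬ (1# ≈ 0#)) × (∀ x → ¬ (x ≈ 0#) → ∃ λ y → (x * y) ≈ 1#)

  HasCard : ℕ → Set (c ⊔ ℓ)
  HasCard n = Inverse setoid (≡.setoid (Fin n))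

  open RS (Semiring.rawSemiring semiring) using (_^_)

  pow : Carrier → ℕ → Carrier
  pow x n = x ^ n

  -- j-th elementary symmetric polynomial of a list of ring elements:
  -- σ_j(x₁,…,x_m) = Σ_{i₁<⋯<i_j} x_{i₁}⋯x_{i_j}, via the standard recursion
  -- σ_0 = 1, σ_{j+1}() = 0, σ_{j+1}(x ∷ xs) = σ_{j+1}(xs) + x·σ_j(xs).
  σ : ℕ → List Carrier → Carrier
  σ zero    _        = 1#
  σ (suc j) []       = 0#
  σ (suc j) (x ∷ xs) = σ (suc j) xs + x * σ j xs

  lam : (q m j : ℕ) → Carrier → Carrier
  lam q m j x = σ j (map (λ i → pow x (Data.Nat._^_ q i)) (upTo m))

module Submission where

open import Defs
open import Level using (Level)
open import Algebra.Bundles using (CommutativeRing)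
open import Data.Nat using (ℕ; _≤_; _<_; _∸_)
open import Data.Nat.GCD using (gcd)
open import Data.Product using (∃)
open import Relation.Binary.PropositionalEquality using (_≡_)

open import Algebra.Bundles using (CommutativeMonoid)
open import Data.Nat as ℕ using (zero; suc; s≤s; z≤n)
import Data.Nat.Properties as ℕ
open import Data.Nat.Combinatorics using (_C_; nCn≡1)
open import Data.Nat.Divisibility using (_∣_; divides)
open import Data.Nat.Primality using (Prime)
open import Data.Nat.GCD using (GCD; gcd-GCD; module Bézout)
open import Data.Fin as Fin using (Fin)
import Data.Fin.Properties as Fin
open import Data.Fin.Permutation using (Permutation; permutation)
open import Data.List using (List; []; _∷_; _++_; _∷ʳ_; map; length; replicate)
open import Data.List.Properties using (length-++; length-replicate)
open import Data.List.Relation.Binary.Pointwise using (Pointwise; []; _∷_)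
open import Data.Product using (Σ; _×_; _,_; proj₁; proj₂)
open import Data.Sum using (inj₁; inj₂)
open import Data.Empty using (⊥; ⊥-elim)
open import Function.Bundles using (Inverse)
open import Relation.Nullary using (Dec; yes; no; ¬?)
open import Relation.Binary.PropositionalEquality as ≡ using (_≢_)
import Algebra.Properties.Semiring.Exp as Exp
import Algebra.Properties.Semiring.Mult as Mult
import Algebra.Properties.CommutativeSemiring.Exp as CommExp
import Algebra.Properties.CommutativeSemiring.Binomial as Binomial
import Algebra.Properties.CommutativeMonoid.Sum as Sum
import Algebra.Solver.Ring.NaturalCoefficients.Default as Solver

-- Let K be the field with N = q^m elements, q = p^e with p prime.
--  (1) Counting in K gives N·x = 0 and x^N = x (Lagrange for the additive and multiplicative
--      groups, via sums over K being invariant under bijections); hence p·1 = 0, so x ↦ x^q is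
--      a ring endomorphism of K (Frobenius).
--  (2) It permutes the conjugates x, x^q, …, x^(q^(m-1)) cyclically and σ_j is invariant under
--      rotation, so every value λ_j(x) lies in 𝔽_q.
--  (3) λ_j is a monic polynomial function of degree q^(m-1) + ⋯ + q^(m-j) < q^m, so by the
--      root bound it takes a nonzero value v = λ_j(α₀).
--  (4) λ_j(u·x) = u^j·λ_j(x) for u ∈ 𝔽_q, and as gcd(j, q - 1) = 1 every element of 𝔽_q is the
--      j-th power of an element of 𝔽_q (Bézout). For y ∈ 𝔽_q choose u ∈ 𝔽_q with u^j = y/v:
--      then λ_j(u·α₀) = y.

module BinomialCoefficients where
  open import Data.Nat
  open import Data.Nat.Properties
  open import Data.Nat.Combinatorics using (k>n⇒nCk≡0; nC1≡n; nCk+nC[k+1]≡[n+1]C[k+1])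
  open import Data.Nat.Divisibility using (∣⇒≤)
  open import Data.Nat.Primality using (euclidsLemma)
  open import Relation.Binary.PropositionalEquality
  open import Data.Nat.Solver using (module +-*-Solver)
  open +-*-Solver

  absorption : ∀ n k → suc k * (suc n C suc k) ≡ suc n * (n C k)
  absorption zero zero = refl
  absorption zero (suc k)
    rewrite k>n⇒nCk≡0 {1} {suc (suc k)} (s≤s (s≤s z≤n)) | k>n⇒nCk≡0 {0} {suc k} (s≤s z≤n)
    = *-zeroʳ (suc (suc k))
  absorption (suc n) zero
    rewrite sym (nCk+nC[k+1]≡[n+1]C[k+1] (suc n) 0) | nC1≡n (suc n)
    = cong (λ x → suc (suc x)) (trans (+-identityʳ n) (sym (*-identityʳ n)))
  absorption (suc n) (suc k) = begin
      suc (suc k) * (suc (suc n) C suc (suc k))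
        ≡⟨ cong (suc (suc k) *_) (nCk+nC[k+1]≡[n+1]C[k+1] (suc n) (suc k)) ⟨
      suc (suc k) * (A + B)
        ≡⟨ solve 3 (λ k A B → (con 1 :+ (con 1 :+ k)) :* (A :+ B)
                             := A :+ ((con 1 :+ k) :* A) :+ (con 1 :+ (con 1 :+ k)) :* B) refl k A B ⟩
      A + suc k * A + suc (suc k) * B
        ≡⟨ cong₂ (λ u v → A + u + v) (absorption n k) (absorption n (suc k)) ⟩
      A + suc n * (n C k) + suc n * (n C suc k)
        ≡⟨ solve 4 (λ A n X Y → A :+ n :* X :+ n :* Y := A :+ n :* (X :+ Y)) refl A (suc n) (n C k) (n C suc k) ⟩
      A + suc n * (n C k + n C suc k)
        ≡⟨ cong (λ u → A + suc n * u) (nCk+nC[k+1]≡[n+1]C[k+1] n k) ⟩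
      A + suc n * A ∎
    where
    open ≡-Reasoning
    A = suc n C suc k
    B = suc n C suc (suc k)

  -- A prime p divides C(p,k) for 0 < k < p: it divides k·C(p,k) = p·C(p-1,k-1) but not k.
  prime∣binomial : ∀ {p} → Prime p → ∀ k → suc k < p → p ∣ p C suc k
  prime∣binomial {suc n} p-prime k k<n
    with euclidsLemma (suc k) (suc n C suc k) p-prime
           (divides (n C k) (trans (absorption n k) (*-comm (suc n) (n C k))))
  ... | inj₂ p∣C = p∣C
  ... | inj₁ p∣k = ⊥-elim (<⇒≱ k<n (∣⇒≤ p∣k))

module LambdaDegree where
  open import Data.Nat
  open import Data.Nat.Properties
  open import Relation.Binary.PropositionalEquality

  -- deg q j m = q^(m-1) + q^(m-2) + ⋯ + q^(m-j): the degree of λ_j as a polynomial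
  -- in x, whose top term is x^(q^(m-1)) ⋯ x^(q^(m-j)).
  deg : ℕ → ℕ → ℕ → ℕ
  deg q zero    m       = 0
  deg q (suc j) zero    = 0
  deg q (suc j) (suc m) = q ^ m + deg q j m

  module _ (q : ℕ) (2≤q : 2 ≤ q) where
    private
      q≢0 : NonZero q
      q≢0 = >-nonZero (≤-trans (s≤s z≤n) 2≤q)

      1≤q^ : ∀ m → 1 ≤ q ^ m
      1≤q^ m = m^n>0 q {{q≢0}} m

      q^+q^≤q^suc : ∀ m → q ^ m + q ^ m ≤ q ^ suc m
      q^+q^≤q^suc m = subst (_≤ q * q ^ m) (cong (q ^ m +_) (+-identityʳ (q ^ m))) (*-monoˡ-≤ (q ^ m) 2≤q)

    deg-suc< : ∀ j m → deg q (suc j) m < q ^ m + deg q j m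
    deg-suc< j zero = s≤s z≤n
    deg-suc< zero (suc m) = +-monoˡ-< 0 (<-≤-trans (m<m+n (q ^ m) (1≤q^ m)) (q^+q^≤q^suc m))
    deg-suc< (suc j) (suc m) =
      ≤-trans (+-monoʳ-< (q ^ m) (deg-suc< j m))
              (+-monoˡ-≤ (q ^ m + deg q j m) (m≤n*m (q ^ m) q {{q≢0}}))

    private
      deg+q^≤q^ : ∀ j m → j ≤ m → deg q j m + q ^ (m ∸ j) ≤ q ^ m
      deg+q^≤q^ zero m _ = ≤-refl
      deg+q^≤q^ (suc j) (suc m) (s≤s j≤m) = begin
        (q ^ m + deg q j m) + q ^ (m ∸ j) ≡⟨ +-assoc (q ^ m) _ _ ⟩
        q ^ m + (deg q j m + q ^ (m ∸ j)) ≤⟨ +-monoʳ-≤ (q ^ m) (deg+q^≤q^ j m j≤m) ⟩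
        q ^ m + q ^ m                     ≤⟨ q^+q^≤q^suc m ⟩
        q ^ suc m                         ∎
        where open ≤-Reasoning

    deg<q^m : ∀ j m → j ≤ m → deg q j m < q ^ m
    deg<q^m j m j≤m = <-≤-trans (m<m+n (deg q j m) (1≤q^ (m ∸ j))) (deg+q^≤q^ j m j≤m)

module ElementarySymmetric {c ℓ : Level} (R : CommutativeRing c ℓ) where
  open CommutativeRing R hiding (zero)
  open Exp semiring using (_^_)
  open import Relation.Binary.Reasoning.Setoid setoid
  open Solver commutativeSemiring

  σ-cong : ∀ j {xs ys} → Pointwise _≈_ xs ys → σ R j xs ≈ σ R j ys
  σ-cong zero    _             = refl
  σ-cong (suc j) []            = refl
  σ-cong (suc j) (x≈y ∷ xs≈ys) = +-cong (σ-cong (suc j) xs≈ys) (*-cong x≈y (σ-cong j xs≈ys))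

  σ-homomorphic : (f : Carrier → Carrier)
                → (∀ a b → f (a + b) ≈ f a + f b) → (∀ a b → f (a * b) ≈ f a * f b)
                → f 1# ≈ 1# → f 0# ≈ 0#
                → ∀ j xs → f (σ R j xs) ≈ σ R j (map f xs)
  σ-homomorphic f f+ f* f1 f0 = go
    where
    go : ∀ j xs → f (σ R j xs) ≈ σ R j (map f xs)
    go zero    xs       = f1
    go (suc j) []       = f0
    go (suc j) (x ∷ xs) = trans (f+ _ _) (+-cong (go (suc j) xs) (trans (f* _ _) (*-congˡ (go j xs))))

  σ-snoc : ∀ j xs a → σ R (suc j) (xs ∷ʳ a) ≈ σ R (suc j) xs + a * σ R j xs
  σ-snoc j [] a = refl
  σ-snoc zero (x ∷ xs) a = begin
    σ R 1 (xs ∷ʳ a) + x * 1#     ≈⟨ +-congʳ (σ-snoc zero xs a) ⟩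
    (σ R 1 xs + a * 1#) + x * 1# ≈⟨ solve 3 (λ A a x → (A :+ a :* con 1) :+ x :* con 1
                                               := (A :+ x :* con 1) :+ a :* con 1) refl (σ R 1 xs) a x ⟩
    (σ R 1 xs + x * 1#) + a * 1# ∎
  σ-snoc (suc j) (x ∷ xs) a = begin
    σ R (suc (suc j)) (xs ∷ʳ a) + x * σ R (suc j) (xs ∷ʳ a) ≈⟨ +-cong (σ-snoc (suc j) xs a) (*-congˡ (σ-snoc j xs a)) ⟩
    (A + a * B) + x * (B + a * C′)                          ≈⟨ solve 5 (λ A B C′ a x → (A :+ a :* B) :+ x :* (B :+ a :* C′)
                                                                        := (A :+ x :* B) :+ a :* (B :+ x :* C′)) refl A B C′ a x ⟩
    (A + x * B) + a * (B + x * C′)                          ∎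
    where
    A = σ R (suc (suc j)) xs
    B = σ R (suc j) xs
    C′ = σ R j xs

  σ-rotate : ∀ j xs a → σ R j (xs ∷ʳ a) ≈ σ R j (a ∷ xs)
  σ-rotate zero    xs a = refl
  σ-rotate (suc j) xs a = σ-snoc j xs a

  σ-scale : ∀ u j xs → σ R j (map (u *_) xs) ≈ u ^ j * σ R j xs
  σ-scale u zero    xs       = sym (*-identityˡ 1#)
  σ-scale u (suc j) []       = sym (zeroʳ _)
  σ-scale u (suc j) (x ∷ xs) = begin
    σ R (suc j) (map (u *_) xs) + (u * x) * σ R j (map (u *_) xs) ≈⟨ +-cong (σ-scale u (suc j) xs) (*-congˡ (σ-scale u j xs)) ⟩
    (u * u ^ j) * A + (u * x) * (u ^ j * B)                       ≈⟨ solve 5 (λ u x U A B → (u :* U) :* A :+ (u :* x) :* (U :* B)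
                                                                                := (u :* U) :* (A :+ x :* B)) refl u x (u ^ j) A B ⟩
    (u * u ^ j) * (A + x * B)                                     ∎
    where
    A = σ R (suc j) xs
    B = σ R j xs

  σ-short : ∀ j xs → length xs < j → σ R j xs ≈ 0#
  σ-short (suc j) []       _             = refl
  σ-short (suc j) (x ∷ xs) (s≤s |xs|<j) = begin
    σ R (suc j) xs + x * σ R j xs ≈⟨ +-cong (σ-short (suc j) xs (ℕ.m<n⇒m<1+n |xs|<j)) (*-congˡ (σ-short j xs |xs|<j)) ⟩
    0# + x * 0#                   ≈⟨ +-identityˡ _ ⟩
    x * 0#                        ≈⟨ zeroʳ x ⟩
    0#                            ∎

module Frobenius {c ℓ : Level} (R : CommutativeRing c ℓ) where
  open CommutativeRing R hiding (zero)
  open Exp semiring using (_^_; ^-congˡ; ^-assocʳ)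
  open Mult semiring using (×-congʳ; ×1-homo-*; ×-assoc-*; ×-homo-1) renaming (_×_ to _·_)
  open Binomial commutativeSemiring using (binomialTerm; theorem)
  open Sum +-commutativeMonoid using (sum; sum-cong-≋; sum-init-last; sum-replicate-zero)
  open import Relation.Binary.Reasoning.Setoid setoid

  module _ (p : ℕ) (p-prime : Prime p) (char-p : p · 1# ≈ 0#) where

    p∣n⇒n·x≈0 : ∀ n x → p ∣ n → n · x ≈ 0#
    p∣n⇒n·x≈0 n x (divides r ≡.refl) = begin
      (r ℕ.* p) · x             ≈⟨ ×-congʳ (r ℕ.* p) (sym (*-identityˡ x)) ⟩
      (r ℕ.* p) · (1# * x)      ≈⟨ ×-assoc-* (r ℕ.* p) 1# x ⟨
      ((r ℕ.* p) · 1#) * x      ≈⟨ *-congʳ (×1-homo-* r p) ⟩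
      ((r · 1#) * (p · 1#)) * x ≈⟨ *-congʳ (*-congˡ char-p) ⟩
      ((r · 1#) * 0#) * x       ≈⟨ *-congʳ (zeroʳ _) ⟩
      0# * x                    ≈⟨ zeroˡ x ⟩
      0#                        ∎

    -- (x + y)^p = x^p + y^p: the inner binomial coefficients are divisible by p.
    frobenius-+ : ∀ x y → (x + y) ^ p ≈ x ^ p + y ^ p
    frobenius-+ x y = dream (ℕ.pred p) (suc-pred p-prime)
      where
      suc-pred : ∀ {n} → Prime n → suc (ℕ.pred n) ≡ n
      suc-pred {suc n} _ = ≡.refl

      dream : ∀ n → suc n ≡ p → (x + y) ^ p ≈ x ^ p + y ^ p
      dream n ≡.refl = begin
        (x + y) ^ suc n                                      ≈⟨ theorem (suc n) x y ⟩
        t Fin.zero + sum (λ i → t (Fin.suc i))               ≈⟨ +-congˡ (sum-init-last (λ i → t (Fin.suc i))) ⟩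
        t Fin.zero + (sum inner + t (Fin.suc (Fin.fromℕ n))) ≈⟨ +-cong first (+-cong inner≈0 last) ⟩
        y ^ suc n + (0# + x ^ suc n)                         ≈⟨ +-congˡ (+-identityˡ _) ⟩
        y ^ suc n + x ^ suc n                                ≈⟨ +-comm _ _ ⟩
        x ^ suc n + y ^ suc n                                ∎
        where
        t = binomialTerm x y (suc n)
        inner = λ i → t (Fin.suc (Fin.inject₁ i))

        first : t Fin.zero ≈ y ^ suc n
        first = trans (×-homo-1 _) (*-identityˡ _)

        last : t (Fin.suc (Fin.fromℕ n)) ≈ x ^ suc n
        last = begin
          t (Fin.suc (Fin.fromℕ n))                     ≡⟨ ≡.cong (λ k → (suc n C k) · (x ^ k * y ^ (suc n ℕ.∸ k))) (≡.cong suc (Fin.toℕ-fromℕ n)) ⟩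
          (suc n C suc n) · (x ^ suc n * y ^ (n ℕ.∸ n)) ≡⟨ ≡.cong₂ (λ a b → a · (x ^ suc n * y ^ b)) (nCn≡1 (suc n)) (ℕ.n∸n≡0 n) ⟩
          1 · (x ^ suc n * 1#)                          ≈⟨ trans (×-homo-1 _) (*-identityʳ _) ⟩
          x ^ suc n                                     ∎

        inner≈0 : sum inner ≈ 0#
        inner≈0 = trans (sum-cong-≋ (λ i → p∣n⇒n·x≈0 _ _ (p∣C i))) (sum-replicate-zero n)
          where
          p∣C : ∀ (i : Fin n) → suc n ∣ suc n C Fin.toℕ (Fin.suc (Fin.inject₁ i))
          p∣C i = BinomialCoefficients.prime∣binomial p-prime (Fin.toℕ (Fin.inject₁ i))
                    (s≤s (ℕ.≤-trans (ℕ.≤-reflexive (≡.cong suc (Fin.toℕ-inject₁ i))) (Fin.toℕ<n i)))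

    frobenius-^-+ : ∀ e x y → (x + y) ^ (p ℕ.^ e) ≈ x ^ (p ℕ.^ e) + y ^ (p ℕ.^ e)
    frobenius-^-+ zero    x y = trans (*-identityʳ _) (+-cong (sym (*-identityʳ x)) (sym (*-identityʳ y)))
    frobenius-^-+ (suc e) x y = begin
      (x + y) ^ (p ℕ.* p ℕ.^ e)                 ≈⟨ ^-assocʳ (x + y) p (p ℕ.^ e) ⟨
      ((x + y) ^ p) ^ (p ℕ.^ e)                 ≈⟨ ^-congˡ (p ℕ.^ e) (frobenius-+ x y) ⟩
      (x ^ p + y ^ p) ^ (p ℕ.^ e)               ≈⟨ frobenius-^-+ e _ _ ⟩
      (x ^ p) ^ (p ℕ.^ e) + (y ^ p) ^ (p ℕ.^ e) ≈⟨ +-cong (^-assocʳ x p (p ℕ.^ e)) (^-assocʳ y p (p ℕ.^ e)) ⟩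
      x ^ (p ℕ.* p ℕ.^ e) + y ^ (p ℕ.* p ℕ.^ e) ∎

-- Functions R → R given by polynomials, represented by coefficient lists (lowest degree first).
module PolynomialFunctions {c ℓ : Level} (R : CommutativeRing c ℓ) where
  open CommutativeRing R hiding (zero)
  open Exp semiring using (_^_)
  open import Relation.Binary.Reasoning.Setoid setoid
  open Solver commutativeSemiring

  eval : List Carrier → Carrier → Carrier
  eval []       x = 0#
  eval (a ∷ as) x = a + x * eval as x

  -- Horner evaluation of c₀ + c₁x + ⋯ + c_{d-1}x^(d-1) + x^d: the coefficients below a leading 1.
  evalMonic : List Carrier → Carrier → Carrier
  evalMonic []       x = 1#
  evalMonic (a ∷ as) x = a + x * evalMonic as x

  DegreeBelow : (Carrier → Carrier) → ℕ → Set _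
  DegreeBelow f d = Σ (List Carrier) λ cs → length cs ≤ d × (∀ x → f x ≈ eval cs x)

  Monic : (Carrier → Carrier) → ℕ → Set _
  Monic f d = Σ (List Carrier) λ cs → length cs ≡ d × (∀ x → f x ≈ evalMonic cs x)

  monic-cong : ∀ {f g d} → (∀ x → f x ≈ g x) → Monic g d → Monic f d
  monic-cong f≈g (cs , len , g≈) = cs , len , λ x → trans (f≈g x) (g≈ x)

  degreeBelow-zero : ∀ {f} d → (∀ x → f x ≈ 0#) → DegreeBelow f d
  degreeBelow-zero d f≈0 = [] , z≤n , f≈0

  degreeBelow-weaken : ∀ {f d d′} → DegreeBelow f d → d ≤ d′ → DegreeBelow f d′
  degreeBelow-weaken (cs , len , f≈) d≤d′ = cs , ℕ.≤-trans len d≤d′ , f≈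

  monic⇒degreeBelow : ∀ {f d} → Monic f d → DegreeBelow f (suc d)
  monic⇒degreeBelow {f} {d} (cs , ≡.refl , f≈) =
    cs ∷ʳ 1# , ℕ.≤-reflexive (≡.trans (length-++ cs) (ℕ.+-comm (length cs) 1)) , λ x → trans (f≈ x) (explicit cs x)
    where
    explicit : ∀ cs x → evalMonic cs x ≈ eval (cs ∷ʳ 1#) x
    explicit []       x = sym (trans (+-congˡ (zeroʳ x)) (+-identityʳ 1#))
    explicit (a ∷ cs) x = +-congˡ (*-congˡ (explicit cs x))

  monic-+-lower : ∀ {f g d} → Monic f d → DegreeBelow g d → Monic (λ x → f x + g x) d
  monic-+-lower {f} {g} (cs , ≡.refl , f≈) (ds , ds≤cs , g≈) =
    add cs ds ds≤cs , length-add cs ds ds≤cs , λ x → trans (+-cong (f≈ x) (g≈ x)) (sym (eval-add cs ds ds≤cs x))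
    where
    add : ∀ cs ds → length ds ≤ length cs → List Carrier
    add cs       []       _         = cs
    add (a ∷ cs) (b ∷ ds) (s≤s len) = a + b ∷ add cs ds len

    length-add : ∀ cs ds le → length (add cs ds le) ≡ length cs
    length-add cs       []       _         = ≡.refl
    length-add (a ∷ cs) (b ∷ ds) (s≤s len) = ≡.cong suc (length-add cs ds len)

    eval-add : ∀ cs ds le x → evalMonic (add cs ds le) x ≈ evalMonic cs x + eval ds x
    eval-add cs       []       _         x = sym (+-identityʳ _)
    eval-add (a ∷ cs) (b ∷ ds) (s≤s len) x = begin
      (a + b) + x * evalMonic (add cs ds len) x      ≈⟨ +-congˡ (*-congˡ (eval-add cs ds len x)) ⟩
      (a + b) + x * (evalMonic cs x + eval ds x)     ≈⟨ solve 5 (λ a b x A B → (a :+ b) :+ x :* (A :+ B)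
                                                                  := (a :+ x :* A) :+ (b :+ x :* B)) refl a b x _ _ ⟩
      (a + x * evalMonic cs x) + (b + x * eval ds x) ∎

  monic-shift : ∀ {f d} e → Monic f d → Monic (λ x → x ^ e * f x) (e ℕ.+ d)
  monic-shift {f} e (cs , ≡.refl , f≈) =
    replicate e 0# ++ cs , ≡.trans (length-++ (replicate e 0#)) (≡.cong (ℕ._+ length cs) (length-replicate e)) ,
    λ x → trans (*-congˡ (f≈ x)) (sym (shift e x))
    where
    shift : ∀ e x → evalMonic (replicate e 0# ++ cs) x ≈ x ^ e * evalMonic cs x
    shift zero    x = sym (*-identityˡ _)
    shift (suc e) x = trans (+-identityˡ _) (trans (*-congˡ (shift e x)) (sym (*-assoc _ _ _)))

  -- Synthetic division by x - a: the coefficients of the quotient.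
  quotient : Carrier → List Carrier → List Carrier
  quotient a []       = []
  quotient a (b ∷ bs) = evalMonic (b ∷ bs) a ∷ quotient a bs

  -- The division identity f(x) = (x - a)·g(x) + f(a), written without subtraction.
  division : ∀ a b bs x → evalMonic (b ∷ bs) x + a * evalMonic (quotient a bs) x
                        ≈ x * evalMonic (quotient a bs) x + evalMonic (b ∷ bs) a
  division a b []       x = solve 3 (λ b x a → (b :+ x :* con 1) :+ a :* con 1 := x :* con 1 :+ (b :+ a :* con 1)) refl b x a
  division a b (d ∷ ds) x = begin
    (b + x * F) + a * (r + x * G) ≈⟨ solve 6 (λ b x a r F G → (b :+ x :* F) :+ a :* (r :+ x :* G)
                                                      := (b :+ a :* r) :+ x :* (F :+ a :* G)) refl b x a r F G ⟩
    (b + a * r) + x * (F + a * G) ≈⟨ +-congˡ (*-congˡ (division a d ds x)) ⟩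
    (b + a * r) + x * (x * G + r) ≈⟨ solve 5 (λ b x a r G → (b :+ a :* r) :+ x :* (x :* G :+ r)
                                                    := x :* (r :+ x :* G) :+ (b :+ a :* r)) refl b x a r G ⟩
    x * (r + x * G) + (b + a * r) ∎
    where
    F = evalMonic (d ∷ ds) x
    r = evalMonic (d ∷ ds) a
    G = evalMonic (quotient a ds) x

  monic-factor : ∀ {f d} → Monic f (suc d) → ∀ a →
                 Σ (Carrier → Carrier) λ g → Monic g d × (∀ x → f x + a * g x ≈ x * g x + f a)
  monic-factor {f} (b ∷ bs , len , f≈) a =
    g , (quotient a bs , ≡.trans (length-quotient bs) (ℕ.suc-injective len) , λ x → refl) ,
    λ x → begin
      f x + a * g x                  ≈⟨ +-congʳ (f≈ x) ⟩
      evalMonic (b ∷ bs) x + a * g x ≈⟨ division a b bs x ⟩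
      x * g x + evalMonic (b ∷ bs) a ≈⟨ +-congˡ (f≈ a) ⟨
      x * g x + f a                  ∎
    where
    g = evalMonic (quotient a bs)
    length-quotient : ∀ bs → length (quotient a bs) ≡ length bs
    length-quotient []       = ≡.refl
    length-quotient (b ∷ bs) = ≡.cong suc (length-quotient bs)

module RingPowers {c ℓ : Level} (R : CommutativeRing c ℓ) where
  open CommutativeRing R hiding (zero)
  open Exp semiring using (_^_; ^-congˡ; ^-assocʳ)
  open CommExp commutativeSemiring using (^-distrib-*)
  open import Relation.Binary.Reasoning.Setoid setoid

  1^≈1 : ∀ n → 1# ^ n ≈ 1#
  1^≈1 zero    = refl
  1^≈1 (suc n) = trans (*-identityˡ _) (1^≈1 n)

  0^≈0 : ∀ {n} → 1 ≤ n → 0# ^ n ≈ 0#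
  0^≈0 {suc n} _ = zeroˡ _

  fixed-^ : ∀ {q u} → u ^ q ≈ u → ∀ k → (u ^ k) ^ q ≈ u ^ k
  fixed-^ {q} {u} u^q≈u k = begin
    (u ^ k) ^ q   ≈⟨ ^-assocʳ u k q ⟩
    u ^ (k ℕ.* q) ≡⟨ ≡.cong (u ^_) (ℕ.*-comm k q) ⟩
    u ^ (q ℕ.* k) ≈⟨ ^-assocʳ u q k ⟨
    (u ^ q) ^ k   ≈⟨ ^-congˡ k u^q≈u ⟩
    u ^ k         ∎

  fixed-* : ∀ {q u v} → u ^ q ≈ u → v ^ q ≈ v → (u * v) ^ q ≈ u * v
  fixed-* {q} {u} {v} u^q≈u v^q≈v = trans (^-distrib-* u v q) (*-cong u^q≈u v^q≈v)

  fixed-^q^ : ∀ {q u} → u ^ q ≈ u → ∀ i → u ^ (q ℕ.^ i) ≈ u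
  fixed-^q^ {q} {u} u^q≈u zero    = *-identityʳ u
  fixed-^q^ {q} {u} u^q≈u (suc i) = trans (sym (^-assocʳ u q (q ℕ.^ i))) (trans (^-congˡ (q ℕ.^ i) u^q≈u) (fixed-^q^ u^q≈u i))

module LambdaFunction {c ℓ : Level} (R : CommutativeRing c ℓ) (q : ℕ) where
  open CommutativeRing R hiding (zero)
  open Exp semiring using (_^_; ^-congˡ; ^-congʳ; ^-assocʳ)
  open CommExp commutativeSemiring using (^-distrib-*)
  open import Relation.Binary.Reasoning.Setoid setoid
  open import Data.List using (applyUpTo)
  open import Data.List.Properties using (map-upTo; map-applyUpTo; applyUpTo-∷ʳ; length-applyUpTo)
  open ElementarySymmetric R
  open PolynomialFunctions R
  open RingPowers R using (1^≈1; 0^≈0; fixed-^q^)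
  open LambdaDegree using (deg; deg-suc<)

  conjugates : Carrier → ℕ → List Carrier
  conjugates x m = applyUpTo (λ i → x ^ (q ℕ.^ i)) m

  lam≡σ-conjugates : ∀ m j x → lam R q m j x ≡ σ R j (conjugates x m)
  lam≡σ-conjugates m j x = ≡.cong (σ R j) (map-upTo (λ i → x ^ (q ℕ.^ i)) m)

  applyUpTo-cong : ∀ {f g : ℕ → Carrier} → (∀ i → f i ≈ g i) → ∀ m → Pointwise _≈_ (applyUpTo f m) (applyUpTo g m)
  applyUpTo-cong f≈g zero    = []
  applyUpTo-cong f≈g (suc m) = f≈g 0 ∷ applyUpTo-cong (λ i → f≈g (suc i)) m

  lam-scale : ∀ {u} → u ^ q ≈ u → ∀ m j x → lam R q m j (u * x) ≈ u ^ j * lam R q m j x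
  lam-scale {u} u^q≈u m j x = begin
    lam R q m j (u * x)                           ≡⟨ lam≡σ-conjugates m j (u * x) ⟩
    σ R j (conjugates (u * x) m)                  ≈⟨ σ-cong j (applyUpTo-cong scale m) ⟩
    σ R j (applyUpTo (λ i → u * x ^ (q ℕ.^ i)) m) ≡⟨ ≡.cong (σ R j) (map-applyUpTo _ (u *_) m) ⟨
    σ R j (map (u *_) (conjugates x m))           ≈⟨ σ-scale u j _ ⟩
    u ^ j * σ R j (conjugates x m)                ≡⟨ ≡.cong (λ v → u ^ j * v) (lam≡σ-conjugates m j x) ⟨
    u ^ j * lam R q m j x                         ∎
    where
    scale : ∀ i → (u * x) ^ (q ℕ.^ i) ≈ u * x ^ (q ℕ.^ i)
    scale i = trans (^-distrib-* u x (q ℕ.^ i)) (*-congʳ (fixed-^q^ u^q≈u i))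

  -- σ_j(x, x^q, …, x^(q^(m-1))) is a monic polynomial function of degree deg q j m: the new
  -- conjugate x^(q^m) multiplies the leading part by x^(q^m), the rest has lower degree.
  σ-conjugates-monic : 2 ≤ q → ∀ {j m} → j ≤ m → Monic (λ x → σ R j (conjugates x m)) (deg q j m)
  σ-conjugates-monic 2≤q {zero}  {m}     _         = [] , ≡.refl , λ x → refl
  σ-conjugates-monic 2≤q {suc j} {suc m} (s≤s j≤m) =
    monic-cong split (monic-+-lower (monic-shift (q ℕ.^ m) (σ-conjugates-monic 2≤q j≤m)) lower)
    where
    split : ∀ x → σ R (suc j) (conjugates x (suc m))
                ≈ x ^ (q ℕ.^ m) * σ R j (conjugates x m) + σ R (suc j) (conjugates x m)
    split x = begin
      σ R (suc j) (conjugates x (suc m))                                    ≡⟨ ≡.cong (σ R (suc j)) (applyUpTo-∷ʳ _ m) ⟨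
      σ R (suc j) (conjugates x m ∷ʳ x ^ (q ℕ.^ m))                         ≈⟨ σ-snoc j _ _ ⟩
      σ R (suc j) (conjugates x m) + x ^ (q ℕ.^ m) * σ R j (conjugates x m) ≈⟨ +-comm _ _ ⟩
      x ^ (q ℕ.^ m) * σ R j (conjugates x m) + σ R (suc j) (conjugates x m) ∎

    lower : DegreeBelow (λ x → σ R (suc j) (conjugates x m)) (q ℕ.^ m ℕ.+ deg q j m)
    lower with ℕ.m≤n⇒m<n∨m≡n j≤m
    ... | inj₁ j<m    = degreeBelow-weaken (monic⇒degreeBelow (σ-conjugates-monic 2≤q j<m)) (deg-suc< q 2≤q j m)
    ... | inj₂ ≡.refl = degreeBelow-zero _ λ x →
                          σ-short (suc j) (conjugates x j) (ℕ.≤-reflexive (≡.cong suc (length-applyUpTo _ j)))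

  lam-monic : 2 ≤ q → ∀ {j m} → j ≤ m → Monic (lam R q m j) (deg q j m)
  lam-monic 2≤q {j} {m} j≤m = monic-cong (λ x → reflexive (lam≡σ-conjugates m j x)) (σ-conjugates-monic 2≤q j≤m)

  -- If x ↦ x^q is additive and x^(q^m) = x, then λ_j(x) is fixed by x ↦ x^q: that ring
  -- endomorphism shifts the conjugates cyclically, and σ_j is invariant under rotation.
  lam-fixed : (∀ a b → (a + b) ^ q ≈ a ^ q + b ^ q) → 1 ≤ q →
              ∀ {m} → 1 ≤ m → ∀ j x → x ^ (q ℕ.^ m) ≈ x → lam R q m j x ^ q ≈ lam R q m j x
  lam-fixed frob-+ 1≤q {suc m} _ j x x^q^m≈x = begin
    lam R q (suc m) j x ^ q                               ≡⟨ ≡.cong (_^ q) (lam≡σ-conjugates (suc m) j x) ⟩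
    σ R j (conjugates x (suc m)) ^ q                      ≈⟨ σ-homomorphic (_^ q) frob-+ (λ a b → ^-distrib-* a b q) (1^≈1 q) (0^≈0 1≤q) j _ ⟩
    σ R j (map (_^ q) (conjugates x (suc m)))             ≡⟨ ≡.cong (σ R j) (map-applyUpTo (λ i → x ^ (q ℕ.^ i)) (_^ q) (suc m)) ⟩
    σ R j (applyUpTo (λ i → (x ^ (q ℕ.^ i)) ^ q) (suc m)) ≈⟨ σ-cong j (applyUpTo-cong next (suc m)) ⟩
    σ R j (applyUpTo shifted (suc m))                     ≡⟨ ≡.cong (σ R j) (applyUpTo-∷ʳ shifted m) ⟨
    σ R j (applyUpTo shifted m ∷ʳ shifted m)              ≈⟨ σ-rotate j _ _ ⟩
    σ R j (shifted m ∷ applyUpTo shifted m)               ≈⟨ σ-cong j (trans x^q^m≈x (sym (*-identityʳ x)) ∷ applyUpTo-cong {shifted} (λ i → refl) m) ⟩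
    σ R j (conjugates x (suc m))                          ≡⟨ lam≡σ-conjugates (suc m) j x ⟨
    lam R q (suc m) j x                                   ∎
    where
    shifted : ℕ → Carrier
    shifted i = x ^ (q ℕ.^ suc i)

    next : ∀ i → (x ^ (q ℕ.^ i)) ^ q ≈ shifted i
    next i = trans (^-assocʳ x (q ℕ.^ i) q) (^-congʳ x (ℕ.*-comm (q ℕ.^ i) q))

module Fields {c ℓ : Level} (K : CommutativeRing c ℓ) (isField : IsField K) where
  open CommutativeRing K hiding (zero)
  open Exp semiring using (_^_; ^-congˡ; ^-assocʳ; ^-homo-*)
  open CommExp commutativeSemiring using (^-distrib-*)
  open import Algebra.Properties.Ring ring using (-‿distribˡ-*)
  open import Relation.Binary.Reasoning.Setoid setoid
  open PolynomialFunctions K using (Monic; monic-factor)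
  open RingPowers K using (1^≈1; fixed-^)

  1≉0 : 1# ≉ 0#
  1≉0 = proj₁ isField

  inverse : ∀ x → x ≉ 0# → Carrier
  inverse x x≉0 = proj₁ (proj₂ isField x x≉0)

  inverseʳ : ∀ x (x≉0 : x ≉ 0#) → x * inverse x x≉0 ≈ 1#
  inverseʳ x x≉0 = proj₂ (proj₂ isField x x≉0)

  inverseˡ : ∀ x (x≉0 : x ≉ 0#) → inverse x x≉0 * x ≈ 1#
  inverseˡ x x≉0 = trans (*-comm _ _) (inverseʳ x x≉0)

  *-cancelˡ : ∀ x → x ≉ 0# → ∀ {a b} → x * a ≈ x * b → a ≈ b
  *-cancelˡ x x≉0 {a} {b} xa≈xb = begin
    a                       ≈⟨ *-identityˡ a ⟨
    1# * a                  ≈⟨ *-congʳ (inverseˡ x x≉0) ⟨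
    (inverse x x≉0 * x) * a ≈⟨ *-assoc _ _ _ ⟩
    inverse x x≉0 * (x * a) ≈⟨ *-congˡ xa≈xb ⟩
    inverse x x≉0 * (x * b) ≈⟨ *-assoc _ _ _ ⟨
    (inverse x x≉0 * x) * b ≈⟨ *-congʳ (inverseˡ x x≉0) ⟩
    1# * b                  ≈⟨ *-identityˡ b ⟩
    b                       ∎

  *-cancelʳ : ∀ x → x ≉ 0# → ∀ {a b} → a * x ≈ b * x → a ≈ b
  *-cancelʳ x x≉0 ax≈bx = *-cancelˡ x x≉0 (trans (*-comm _ _) (trans ax≈bx (*-comm _ _)))

  *-nonzero : ∀ {x y} → x ≉ 0# → y ≉ 0# → x * y ≉ 0#
  *-nonzero {x} {y} x≉0 y≉0 xy≈0 = y≉0 (*-cancelˡ x x≉0 (trans xy≈0 (sym (zeroʳ x))))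

  ^-nonzero : ∀ {x} → x ≉ 0# → ∀ n → x ^ n ≉ 0#
  ^-nonzero x≉0 zero    = 1≉0
  ^-nonzero x≉0 (suc n) = *-nonzero x≉0 (^-nonzero x≉0 n)

  -- If a ≠ b then a·z = b·z forces z = 0, since a - b is invertible.
  distinct-cancel : ∀ {a b z} → a ≉ b → a * z ≈ b * z → z ≈ 0#
  distinct-cancel {a} {b} {z} a≉b az≈bz = *-cancelˡ (a - b) a-b≉0 (begin
    (a - b) * z      ≈⟨ distribʳ z a (- b) ⟩
    a * z + - b * z  ≈⟨ +-cong az≈bz (sym (-‿distribˡ-* b z)) ⟩
    b * z - b * z    ≈⟨ -‿inverseʳ (b * z) ⟩
    0#               ≈⟨ zeroʳ (a - b) ⟨
    (a - b) * 0#     ∎)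
    where
    a-b≉0 : a - b ≉ 0#
    a-b≉0 a-b≈0 = a≉b (begin
      a                ≈⟨ +-identityʳ a ⟨
      a + 0#           ≈⟨ +-congˡ (-‿inverseˡ b) ⟨
      a + (- b + b)    ≈⟨ +-assoc a (- b) b ⟨
      (a - b) + b      ≈⟨ +-congʳ a-b≈0 ⟩
      0# + b           ≈⟨ +-identityˡ b ⟩
      b                ∎)

  -- Root bound: a monic polynomial function of degree d has no d + 1 distinct roots.
  -- Factor out x - a at the first root; the quotient vanishes at the remaining d roots.
  monic-root-bound : ∀ {f d} → Monic f d → (roots : Fin (suc d) → Carrier)
                   → (∀ i j → roots i ≈ roots j → i ≡ j) → (∀ i → f (roots i) ≈ 0#) → ⊥
  monic-root-bound {d = zero}  ([] , _ , f≈1) roots _ f≈0 = 1≉0 (trans (sym (f≈1 (roots Fin.zero))) (f≈0 Fin.zero))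
  monic-root-bound {f} {suc d} f-monic roots distinct f≈0 with monic-factor f-monic (roots Fin.zero)
  ... | g , g-monic , division =
    monic-root-bound g-monic (λ i → roots (Fin.suc i)) (λ i j eq → Fin.suc-injective (distinct _ _ eq)) g≈0
    where
    a = roots Fin.zero
    g≈0 : ∀ i → g (roots (Fin.suc i)) ≈ 0#
    g≈0 i = distinct-cancel (λ a≈x → Fin.0≢1+n (distinct _ _ a≈x)) (begin
      a * g x          ≈⟨ +-identityˡ _ ⟨
      0# + a * g x     ≈⟨ +-congʳ (f≈0 (Fin.suc i)) ⟨
      f x + a * g x    ≈⟨ division x ⟩
      x * g x + f a    ≈⟨ +-congˡ (f≈0 Fin.zero) ⟩
      x * g x + 0#     ≈⟨ +-identityʳ _ ⟩
      x * g x          ∎)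
      where x = roots (Fin.suc i)

  fixed-inverse : ∀ {q u} (u≉0 : u ≉ 0#) → u ^ q ≈ u → inverse u u≉0 ^ q ≈ inverse u u≉0
  fixed-inverse {q} {u} u≉0 u^q≈u = *-cancelʳ u u≉0 (begin
    v ^ q * u     ≈⟨ *-congˡ u^q≈u ⟨
    v ^ q * u ^ q ≈⟨ ^-distrib-* v u q ⟨
    (v * u) ^ q   ≈⟨ ^-congˡ q (inverseˡ u u≉0) ⟩
    1# ^ q        ≈⟨ 1^≈1 q ⟩
    1#            ≈⟨ inverseˡ u u≉0 ⟨
    v * u         ∎)
    where v = inverse u u≉0

  fixed⇒root-of-unity : ∀ {q w} → 1 ≤ q → w ≉ 0# → w ^ q ≈ w → ∀ y → w ^ (y ℕ.* (q ∸ 1)) ≈ 1#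
  fixed⇒root-of-unity {q} {w} 1≤q w≉0 w^q≈w y = begin
    w ^ (y ℕ.* (q ∸ 1)) ≡⟨ ≡.cong (w ^_) (ℕ.*-comm y (q ∸ 1)) ⟩
    w ^ ((q ∸ 1) ℕ.* y) ≈⟨ ^-assocʳ w (q ∸ 1) y ⟨
    (w ^ (q ∸ 1)) ^ y   ≈⟨ ^-congˡ y w^[q-1]≈1 ⟩
    1# ^ y              ≈⟨ 1^≈1 y ⟩
    1#                  ∎
    where
    w^[q-1]≈1 : w ^ (q ∸ 1) ≈ 1#
    w^[q-1]≈1 = *-cancelˡ w w≉0 (begin
      w * w ^ (q ∸ 1) ≡⟨ ≡.cong (w ^_) (ℕ.m+[n∸m]≡n 1≤q) ⟩
      w ^ q           ≈⟨ w^q≈w ⟩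
      w               ≈⟨ *-identityʳ w ⟨
      w * 1#          ∎)

  -- By Bézout, xj = 1 + y(q-1) or 1 + xj = y(q-1); since w^(q-1) = 1,
  -- u = w^x, resp. u = (w^x)⁻¹, works.
  fixed-root : ∀ {q j w} → 1 ≤ q → gcd j (q ∸ 1) ≡ 1 → w ≉ 0# → w ^ q ≈ w
             → ∃ λ u → u ^ q ≈ u × u ^ j ≈ w
  fixed-root {q} {j} {w} 1≤q coprime w≉0 w^q≈w
    with Bézout.identity (≡.subst (GCD j (q ∸ 1)) coprime (gcd-GCD j (q ∸ 1)))
  ... | Bézout.+- x y eq = w ^ x , fixed-^ {q} w^q≈w x , (begin
    (w ^ x) ^ j                 ≈⟨ ^-assocʳ w x j ⟩
    w ^ (x ℕ.* j)               ≡⟨ ≡.cong (w ^_) eq ⟨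
    w ^ (1 ℕ.+ y ℕ.* (q ∸ 1))   ≈⟨ ^-homo-* w 1 (y ℕ.* (q ∸ 1)) ⟩
    w ^ 1 * w ^ (y ℕ.* (q ∸ 1)) ≈⟨ *-cong (*-identityʳ w) (fixed⇒root-of-unity {q} 1≤q w≉0 w^q≈w y) ⟩
    w * 1#                      ≈⟨ *-identityʳ w ⟩
    w                           ∎)
  ... | Bézout.-+ x y eq = inverse u u≉0 , fixed-inverse {q} u≉0 (fixed-^ {q} w^q≈w x) ,
    *-cancelʳ (u ^ j) (^-nonzero u≉0 j) (begin
      inverse u u≉0 ^ j * u ^ j   ≈⟨ ^-distrib-* _ _ j ⟨
      (inverse u u≉0 * u) ^ j     ≈⟨ ^-congˡ j (inverseˡ u u≉0) ⟩
      1# ^ j                      ≈⟨ 1^≈1 j ⟩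
      1#                          ≈⟨ fixed⇒root-of-unity {q} 1≤q w≉0 w^q≈w y ⟨
      w ^ (y ℕ.* (q ∸ 1))         ≡⟨ ≡.cong (w ^_) eq ⟨
      w ^ (1 ℕ.+ x ℕ.* j)         ≈⟨ ^-homo-* w 1 (x ℕ.* j) ⟩
      w ^ 1 * w ^ (x ℕ.* j)       ≈⟨ *-cong (*-identityʳ w) (sym (^-assocʳ w x j)) ⟩
      w * u ^ j                   ∎)
    where
    u = w ^ x
    u≉0 = ^-nonzero w≉0 x

module CommutativeMonoidSums {c ℓ : Level} (M : CommutativeMonoid c ℓ) where
  open CommutativeMonoid M
  open Sum M using (sum; sum-cong-≋; sum-remove)
  open import Data.Vec.Functional using (removeAt)
  open import Relation.Binary.Reasoning.Setoid setoid

  sum-except-one : ∀ {n} x (a b : Fin n → Carrier) (i₀ : Fin n)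
                 → (∀ i → i ≢ i₀ → a i ≈ b i) → b i₀ ≈ x ∙ a i₀ → sum b ≈ x ∙ sum a
  sum-except-one {suc n} x a b i₀ a≈b b≈xa = begin
    sum b                               ≈⟨ sum-remove {i = i₀} b ⟩
    b i₀ ∙ sum (removeAt b i₀)          ≈⟨ ∙-cong b≈xa (sum-cong-≋ (λ i → sym (a≈b _ (Fin.punchInᵢ≢i i₀ i)))) ⟩
    (x ∙ a i₀) ∙ sum (removeAt a i₀)    ≈⟨ assoc _ _ _ ⟩
    x ∙ (a i₀ ∙ sum (removeAt a i₀))    ≈⟨ ∙-congˡ (sym (sum-remove {i = i₀} a)) ⟩
    x ∙ sum a                           ∎

module FiniteFields {c ℓ : Level} (K : CommutativeRing c ℓ) (isField : IsField K)
                    (N : ℕ) (card : HasCard K N) where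
  open CommutativeRing K hiding (zero)
  open Inverse card using (to; from; to-cong; strictlyInverseˡ; strictlyInverseʳ)
  open Exp semiring using (_^_; ^-congˡ)
  open Mult semiring using (×1-homo-*) renaming (_×_ to _·_)
  open import Algebra.Properties.Group +-group using (identityˡ-unique)
  open import Relation.Binary.Reasoning.Setoid setoid
  open Fields K isField
  open PolynomialFunctions K using (Monic)
  open RingPowers K using (0^≈0)

  1≤N : 1 ≤ N
  1≤N = ℕ.≤-trans (s≤s z≤n) (Fin.toℕ<n (to 0#))

  _≟_ : ∀ x y → Dec (x ≈ y)
  x ≟ y with to x Fin.≟ to y
  ... | yes tx≡ty = yes (begin
    x             ≈⟨ strictlyInverseʳ x ⟨
    from (to x)   ≡⟨ ≡.cong from tx≡ty ⟩
    from (to y)   ≈⟨ strictlyInverseʳ y ⟩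
    y             ∎)
  ... | no tx≢ty  = no (λ x≈y → tx≢ty (to-cong x≈y))

  module Summation {c′ ℓ′ : Level} (M : CommutativeMonoid c′ ℓ′) where
    private module M = CommutativeMonoid M
    open Sum M using (sum; sum-permute; sum-cong-≋)

    sum-bijection : (h : Carrier → M.Carrier) → (∀ {a b} → a ≈ b → h a M.≈ h b)
                  → (f g : Carrier → Carrier) → (∀ {a b} → a ≈ b → f a ≈ f b) → (∀ {a b} → a ≈ b → g a ≈ g b)
                  → (∀ a → f (g a) ≈ a) → (∀ a → g (f a) ≈ a)
                  → sum (λ i → h (f (from i))) M.≈ sum (λ i → h (from i))
    sum-bijection h h-cong f g f-cong g-cong fg≈id gf≈id = M.sym (M.trans
      (sum-permute (λ i → h (from i)) π)
      (sum-cong-≋ (λ i → h-cong (strictlyInverseʳ (f (from i))))))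
      where
      transport : (Carrier → Carrier) → Fin N → Fin N
      transport k i = to (k (from i))

      inverse-pair : ∀ k l → (∀ {a b} → a ≈ b → k a ≈ k b) → (∀ a → k (l a) ≈ a) → ∀ i → transport k (transport l i) ≡ i
      inverse-pair k l k-cong kl≈id i = ≡.trans (to-cong (trans (k-cong (strictlyInverseʳ _)) (kl≈id (from i)))) (strictlyInverseˡ i)

      π : Permutation N N
      π = permutation (transport f) (transport g) (inverse-pair f g f-cong fg≈id) (inverse-pair g f g-cong gf≈id)

  open Summation using (sum-bijection)
  open Sum +-commutativeMonoid using () renaming (sum to Σ′; ∑-distrib-+ to Σ′-distrib; sum-replicate to Σ′-replicate)
  open Sum *-commutativeMonoid using () renaming (sum to Π; ∑-distrib-+ to Π-distrib; sum-replicate to Π-replicate)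
  open CommutativeMonoidSums *-commutativeMonoid using () renaming (sum-except-one to Π-except-one)

  -- Additive Lagrange: N·x = 0, because translating by x permutes K, so
  -- N·x + Σ_a a = Σ_a (x + a) = Σ_a a.
  N·x≈0 : ∀ x → N · x ≈ 0#
  N·x≈0 x = identityˡ-unique (N · x) (Σ′ from) (begin
    N · x + Σ′ from            ≈⟨ +-congʳ (Σ′-replicate N) ⟨
    Σ′ {N} (λ _ → x) + Σ′ from ≈⟨ Σ′-distrib {N} (λ _ → x) from ⟨
    Σ′ (λ i → x + from i)      ≈⟨ sum-bijection +-commutativeMonoid (λ a → a) (λ a≈b → a≈b) (x +_) (- x +_)
                                    +-congˡ +-congˡ x+[-x+a]≈a [-x]+[x+a]≈a ⟩
    Σ′ from                    ∎)
    where
    x+[-x+a]≈a : ∀ a → x + (- x + a) ≈ a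
    x+[-x+a]≈a a = trans (sym (+-assoc _ _ _)) (trans (+-congʳ (-‿inverseʳ x)) (+-identityˡ a))
    [-x]+[x+a]≈a : ∀ a → - x + (x + a) ≈ a
    [-x]+[x+a]≈a a = trans (sym (+-assoc _ _ _)) (trans (+-congʳ (-‿inverseˡ x)) (+-identityˡ a))

  -- unitPart a = a if a ≠ 0 and 1 if a = 0: the product of all unitPart a is nonzero.
  unitPart : Carrier → Carrier
  unitPart a with a ≟ 0#
  ... | yes _ = 1#
  ... | no  _ = a

  unitPart-nonzero : ∀ a → unitPart a ≉ 0#
  unitPart-nonzero a with a ≟ 0#
  ... | yes _   = 1≉0
  ... | no  a≉0 = a≉0

  unitPart-cong : ∀ {a b} → a ≈ b → unitPart a ≈ unitPart b
  unitPart-cong {a} {b} a≈b with a ≟ 0# | b ≟ 0#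
  ... | yes _   | yes _   = refl
  ... | yes a≈0 | no  b≉0 = ⊥-elim (b≉0 (trans (sym a≈b) a≈0))
  ... | no  a≉0 | yes b≈0 = ⊥-elim (a≉0 (trans a≈b b≈0))
  ... | no  _   | no  _   = a≈b

  unitPart-zero : ∀ {a} → a ≈ 0# → unitPart a ≈ 1#
  unitPart-zero {a} a≈0 with a ≟ 0#
  ... | yes _   = refl
  ... | no  a≉0 = ⊥-elim (a≉0 a≈0)

  unitPart-nonzero-id : ∀ {a} → a ≉ 0# → unitPart a ≈ a
  unitPart-nonzero-id {a} a≉0 with a ≟ 0#
  ... | yes a≈0 = ⊥-elim (a≉0 a≈0)
  ... | no  _   = refl

  -- Fermat: x^N = x. For x ≠ 0, scaling by x permutes K, so with G = Π_a unitPart(a):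
  -- x^N·G = Π_a x·unitPart(a) = x·Π_a unitPart(x·a) = x·G, the factors differing only at a = 0.
  fermat : ∀ x → x ^ N ≈ x
  fermat x with x ≟ 0#
  ... | yes x≈0 = trans (^-congˡ N x≈0) (trans (0^≈0 1≤N) (sym x≈0))
  ... | no  x≉0 = *-cancelʳ G (Π-nonzero N _ (λ i → unitPart-nonzero (from i))) (begin
    x ^ N * G                               ≈⟨ *-congʳ (Π-replicate N) ⟨
    Π {N} (λ _ → x) * G                     ≈⟨ Π-distrib {N} (λ _ → x) (λ i → unitPart (from i)) ⟨
    Π (λ i → x * unitPart (from i))         ≈⟨ Π-except-one x (λ i → unitPart (x * from i)) _ (to 0#) agree differ ⟩
    x * Π (λ i → unitPart (x * from i))     ≈⟨ *-congˡ (sum-bijection *-commutativeMonoid unitPart unitPart-cong (x *_) (x⁻¹ *_)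
                                                   *-congˡ *-congˡ (cancel x (inverseʳ x x≉0)) (cancel x⁻¹ (inverseˡ x x≉0))) ⟩
    x * G                                   ∎)
    where
    G = Π (λ i → unitPart (from i))
    x⁻¹ = inverse x x≉0

    Π-nonzero : ∀ n (f : Fin n → Carrier) → (∀ i → f i ≉ 0#) → Π f ≉ 0#
    Π-nonzero zero    f f≉0 = 1≉0
    Π-nonzero (suc n) f f≉0 = *-nonzero (f≉0 Fin.zero) (Π-nonzero n (λ i → f (Fin.suc i)) (λ i → f≉0 (Fin.suc i)))

    cancel : ∀ u {v} → u * v ≈ 1# → ∀ a → u * (v * a) ≈ a
    cancel u uv≈1 a = trans (sym (*-assoc _ _ _)) (trans (*-congʳ uv≈1) (*-identityˡ a))

    agree : ∀ i → i ≢ to 0# → unitPart (x * from i) ≈ x * unitPart (from i)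
    agree i i≢0 = trans (unitPart-nonzero-id (*-nonzero x≉0 a≉0)) (*-congˡ (sym (unitPart-nonzero-id a≉0)))
      where
      a≉0 : from i ≉ 0#
      a≉0 a≈0 = i≢0 (≡.trans (≡.sym (strictlyInverseˡ i)) (to-cong a≈0))

    differ : x * unitPart (from (to 0#)) ≈ x * unitPart (x * from (to 0#))
    differ = *-congˡ (trans (unitPart-zero (strictlyInverseʳ 0#))
                            (sym (unitPart-zero (trans (*-congˡ (strictlyInverseʳ 0#)) (zeroʳ x)))))

  -- If N = p^e then p·1 = 0: (p·1)^e = (p^e)·1 = N·1 = 0, while powers of nonzero elements are nonzero.
  characteristic : ∀ p e → N ≡ p ℕ.^ e → p · 1# ≈ 0#
  characteristic p e N≡p^e with (p · 1#) ≟ 0#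
  ... | yes p·1≈0 = p·1≈0
  ... | no  p·1≉0 = ⊥-elim (^-nonzero p·1≉0 e (begin
    (p · 1#) ^ e   ≈⟨ ·1-^ e ⟩
    (p ℕ.^ e) · 1# ≡⟨ ≡.cong (_· 1#) N≡p^e ⟨
    N · 1#         ≈⟨ N·x≈0 1# ⟩
    0#             ∎))
    where
    ·1-^ : ∀ e → (p · 1#) ^ e ≈ (p ℕ.^ e) · 1#
    ·1-^ zero    = sym (+-identityʳ 1#)
    ·1-^ (suc e) = trans (*-congˡ (·1-^ e)) (sym (×1-homo-* p (p ℕ.^ e)))

  -- A monic polynomial function of degree below N does not vanish on all of K:
  -- otherwise it would have more roots than its degree.
  monic-nonroot : ∀ {f d} → Monic f d → d < N → ∃ λ x → f x ≉ 0#
  monic-nonroot {f} f-monic d<N with Fin.any? (λ i → ¬? (f (from i) ≟ 0#))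
  ... | yes (i , fi≉0) = from i , fi≉0
  ... | no  none       = ⊥-elim (monic-root-bound f-monic (λ i → from (Fin.inject≤ i d<N)) distinct vanishes)
    where
    distinct : ∀ i j → from (Fin.inject≤ i d<N) ≈ from (Fin.inject≤ j d<N) → i ≡ j
    distinct i j eq = Fin.inject≤-injective d<N d<N i j
      (≡.trans (≡.sym (strictlyInverseˡ _)) (≡.trans (to-cong eq) (strictlyInverseˡ _)))
    vanishes : ∀ i → f (from (Fin.inject≤ i d<N)) ≈ 0#
    vanishes i with f (from (Fin.inject≤ i d<N)) ≟ 0#
    ... | yes fi≈0 = fi≈0
    ... | no  fi≉0 = ⊥-elim (none (_ , fi≉0))

  fixed-jth-root : ∀ {q j w} → 1 ≤ q → 1 ≤ j → gcd j (q ∸ 1) ≡ 1 → w ^ q ≈ w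
                 → ∃ λ u → u ^ q ≈ u × u ^ j ≈ w
  fixed-jth-root {q} {j} {w} 1≤q 1≤j coprime w^q≈w with w ≟ 0#
  ... | yes w≈0 = 0# , 0^≈0 1≤q , trans (0^≈0 1≤j) (sym w≈0)
  ... | no  w≉0 = fixed-root {q} {j} 1≤q coprime w≉0 w^q≈w

module LambdaOnFiniteField {c ℓ : Level} (K : CommutativeRing c ℓ) (isField : IsField K)
                           {q m p e : ℕ} (card : HasCard K (q ℕ.^ m))
                           (p-prime : Prime p) (1≤e : 1 ≤ e) (q≡p^e : q ≡ p ℕ.^ e) where
  open CommutativeRing K hiding (zero)
  open Exp semiring using (_^_)
  open import Relation.Binary.Reasoning.Setoid setoid
  open Fields K isField using (inverse; inverseˡ; fixed-inverse)
  open FiniteFields K isField (q ℕ.^ m) card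
  open LambdaFunction K q using (lam-scale; lam-monic; lam-fixed)
  open RingPowers K using (fixed-*)

  2≤q : 2 ≤ q
  2≤q rewrite q≡p^e = 2≤p^e p e p-prime 1≤e
    where
    2≤p^e : ∀ p e → Prime p → 1 ≤ e → 2 ≤ p ℕ.^ e
    2≤p^e (suc (suc p)) (suc e) _ _ =
      ℕ.≤-trans (s≤s (s≤s z≤n)) (ℕ.m≤m*n (suc (suc p)) (suc (suc p) ℕ.^ e) {{ℕ.m^n≢0 (suc (suc p)) e}})

  1≤q : 1 ≤ q
  1≤q = ℕ.≤-trans (s≤s z≤n) 2≤q

  -- x ↦ x^q is additive, being a power of the Frobenius map x ↦ x^p.
  frobenius-q : ∀ a b → (a + b) ^ q ≈ a ^ q + b ^ q
  frobenius-q = ≡.subst (λ n → ∀ a b → (a + b) ^ n ≈ a ^ n + b ^ n) (≡.sym q≡p^e)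
    (Frobenius.frobenius-^-+ K p p-prime (characteristic p (e ℕ.* m) q^m≡p^[em]) e)
    where
    q^m≡p^[em] : q ℕ.^ m ≡ p ℕ.^ (e ℕ.* m)
    q^m≡p^[em] = ≡.trans (≡.cong (ℕ._^ m) q≡p^e) (ℕ.^-*-assoc p e m)

  lam-in-𝔽q : 1 ≤ m → ∀ j x → lam K q m j x ^ q ≈ lam K q m j x
  lam-in-𝔽q 1≤m j x = lam-fixed frobenius-q 1≤q 1≤m j x (fermat x)

  -- λ_j does not vanish identically: it is monic of degree < q^m.
  lam-nonzero : ∀ {j} → j ≤ m → ∃ λ α → lam K q m j α ≉ 0#
  lam-nonzero j≤m = monic-nonroot (lam-monic 2≤q j≤m) (LambdaDegree.deg<q^m q 2≤q _ m j≤m)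

  -- Scaling: if v = λ_j(α₀) ≠ 0, pick u ∈ 𝔽_q with u^j = y/v (possible as y/v ∈ 𝔽_q);
  -- then λ_j(u·α₀) = u^j·v = y by homogeneity.
  lam-hits : ∀ {j} → 1 ≤ m → 1 ≤ j → gcd j (q ∸ 1) ≡ 1 → ∀ y → y ^ q ≈ y
           → ∀ α₀ → lam K q m j α₀ ≉ 0# → ∃ λ α → lam K q m j α ≈ y
  lam-hits {j} 1≤m 1≤j coprime y y^q≈y α₀ v≉0 = scale (fixed-jth-root {q} {j} 1≤q 1≤j coprime y/v∈𝔽q)
    where
    v = lam K q m j α₀
    v⁻¹ = inverse v v≉0

    y/v∈𝔽q : (y * v⁻¹) ^ q ≈ y * v⁻¹
    y/v∈𝔽q = fixed-* {q} y^q≈y (fixed-inverse {q} v≉0 (lam-in-𝔽q 1≤m j α₀))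

    scale : (∃ λ u → u ^ q ≈ u × u ^ j ≈ y * v⁻¹) → ∃ λ α → lam K q m j α ≈ y
    scale (u , u^q≈u , u^j≈y/v) = u * α₀ , (begin
      lam K q m j (u * α₀)  ≈⟨ lam-scale u^q≈u m j α₀ ⟩
      u ^ j * v             ≈⟨ *-congʳ u^j≈y/v ⟩
      (y * v⁻¹) * v         ≈⟨ *-assoc y v⁻¹ v ⟩
      y * (v⁻¹ * v)         ≈⟨ *-congˡ (inverseˡ v v≉0) ⟩
      y * 1#                ≈⟨ *-identityʳ y ⟩
      y                     ∎)

  lam-surjective : ∀ {j} → 1 ≤ m → 1 ≤ j → j ≤ m → gcd j (q ∸ 1) ≡ 1
                 → ∀ y → y ^ q ≈ y → ∃ λ α → lam K q m j α ≈ y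
  lam-surjective 1≤m 1≤j j≤m coprime y y∈𝔽q =
    let (α₀ , λ[α₀]≉0) = lam-nonzero j≤m in lam-hits 1≤m 1≤j coprime y y∈𝔽q α₀ λ[α₀]≉0

lemma3p2 : ∀ {c ℓ : Level} (q m j : ℕ) → IsPrimePower q → 1 < m
           → 1 ≤ j → j ≤ m ∸ 1 → gcd j (q ∸ 1) ≡ 1
           → (K : CommutativeRing c ℓ) → IsField K → HasCard K (q Data.Nat.^ m)
           → ∀ (y : CommutativeRing.Carrier K)
           → CommutativeRing._≈_ K (pow K y q) y
           → ∃ λ (α : CommutativeRing.Carrier K) → CommutativeRing._≈_ K (lam K q m j α) y
lemma3p2 q m j (p , e , p-prime , 1≤e , q≡p^e) 1<m 1≤j j≤m-1 coprime K isField card y y∈𝔽q =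
  LambdaOnFiniteField.lam-surjective K isField card p-prime 1≤e q≡p^e
    (ℕ.<⇒≤ 1<m) 1≤j (ℕ.≤-trans j≤m-1 (ℕ.m∸n≤m m 1)) coprime y y∈𝔽q
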